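{- Let $w$ be a finite word, let $*$ be a letter not occurring in $w$, and let $w^*$ denote the word obtained by appending $*$ at the end of $w$. Let $u$ be a non-empty factor of $w$ with $m(u) \geq 2$. Then for every integer $i$ with $1 \leq i \leq m(u)-1$, the word $u(i)$ is a right-special factor of $w^*$.
   Context: Words are finite sequences of letters; $u$ is a factor of $w$ if $w=pus$ for some words $p,s$. For a non-empty word $u$ and a positive rational number $r = a/|u|$ (with $a$ a positive integer), the rational power $u^{r}$ is defined as follows: write $a = c|u| + d$ with integers $c \ge 0$, $0 \le d < |u|$; then $u^{r} = u^c u'$, where $u^c$ is the concatenation of $c$ copies of $u$ and $u'$ is the prefix of $u$ of length $d$. For a non-empty factor $u$ of $w$, $m(u) = \max\{r \in \mathbb{Q}^+ : u^r \text{ is a factor of } w\}$ (the maximum taken over those $r$ for which $u^r$ is defined). For an integer $i$ with $1 \le i \le m(u)$, $u(i)$ denotes the shortest suffix of $u^{m(u)}$ that has $u^i$ as a prefix. A factor $x$ of a word $z$ is right-special in $z$ if there exist two different letters $a,b$ of $z$ such that $xa$ and $xb$ are both factors of $z$. -}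

module Defs where

open import Data.List using (List; []; _∷_; _++_; length; concat; replicate; take)
open import Data.Nat using (ℕ; _≤_)
open import Data.Nat.DivMod using (_/_; _%_)
open import Data.Product using (Σ; ∃; ∃₂; _×_; _,_)
open import Relation.Binary.PropositionalEquality using (_≡_; _≢_)

Factor : {A : Set} → List A → List A → Set
Factor {A} u w = ∃₂ λ (p s : List A) → w ≡ p ++ u ++ s

Suffix : {A : Set} → List A → List A → Set
Suffix {A} x v = ∃ λ (p : List A) → v ≡ p ++ x

Prefix : {A : Set} → List A → List A → Set
Prefix {A} p x = ∃ λ (s : List A) → x ≡ p ++ s

-- Rational power u^(a/|u|) for non-empty u, exactly as in the paper:
-- a = c|u| + d, 0 ≤ d < |u|, u^(a/|u|) = u^c u' with u' the prefix of u of length d.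
-- (For u = [] the power is undefined; we return [] there, it is never used.)
pow : {A : Set} → List A → ℕ → List A
pow [] a = []
pow (c ∷ cs) a =
  concat (replicate (a / length (c ∷ cs)) (c ∷ cs)) ++ take (a % length (c ∷ cs)) (c ∷ cs)

-- m(u) = M / |u| where M is the largest positive integer a with u^(a/|u|) a factor of w.
IsMaxExp : {A : Set} → List A → List A → ℕ → Set
IsMaxExp u w M =
  (1 ≤ M) × Factor (pow u M) w × (∀ a → 1 ≤ a → Factor (pow u a) w → a ≤ M)

IsUi : {A : Set} → List A → ℕ → ℕ → List A → Set
IsUi {A} u M i x =
  Suffix x (pow u M) × Prefix (pow u (i Data.Nat.* length u)) x ×
  (∀ (y : List A) → Suffix y (pow u M) → Prefix (pow u (i Data.Nat.* length u)) y →
     length x ≤ length y)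

RightSpecial : {A : Set} → List A → List A → Set
RightSpecial {A} x z =
  ∃₂ λ (a b : A) → a ≢ b × Factor (x ++ a ∷ []) z × Factor (x ++ b ∷ []) z

{-# OPTIONS --safe #-}
-- Write P = u^{m(u)}.  Since m(u) ≥ i + 1, P = u Q with Q = u^{m(u)-1} still
-- beginning with u^i, so the shortest suffix x = u(i) of P lies inside Q.  Hence
-- x is followed in P by the letter d that continues the period of u, while x,
-- being a suffix of P, is followed in w* by whatever follows that occurrence of
-- P: either the end marker *, which is not d because d occurs in w, or a letter
-- e ≠ d, since P d = u^{m(u) + 1/|u|} is not a factor of w by maximality.
module Submission where

open import Defs
open import Data.Empty using (⊥-elim)
open import Data.Fin using (fromℕ<)
open import Data.Fin.Properties using (toℕ-fromℕ<)
open import Data.List using (List; []; _∷_; _++_; [_]; length; lookup; concat; replicate; take)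
open import Data.List.Properties using (++-assoc; ++-identityʳ; length-++; ∷-injectiveʳ; take-suc; take-all)
open import Data.List.Membership.Propositional using (_∈_; _∉_)
open import Data.List.Membership.Propositional.Properties using (∈-++⁺ˡ; ∈-++⁺ʳ)
open import Data.List.Relation.Unary.Any using (here)
open import Data.Nat using (ℕ; zero; suc; _≤_; _<_; _*_; _+_; _∸_; z≤n; s≤s; _≤′_; ≤′-refl; ≤′-step)
open import Data.Nat.Divisibility using (n∣m*n)
open import Data.Nat.DivMod
open import Data.Nat.Properties
open import Data.Product using (∃; _×_; _,_; proj₁; proj₂)
open import Data.Sum using (_⊎_; inj₁; inj₂)
open import Relation.Binary.PropositionalEquality using (_≡_; _≢_; refl; sym; trans; cong; cong₂; subst; module ≡-Reasoning)
open ≡-Reasoning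

private variable
  A : Set
  a : A
  x y z w : List A

Prefix⇒Factor : Prefix x y → Factor x y
Prefix⇒Factor (s , eq) = [] , s , eq

Suffix⇒Factor : Suffix x y → Factor x y
Suffix⇒Factor {x = x} (p , refl) = p , [] , cong (p ++_) (sym (++-identityʳ x))

Prefix-trans : Prefix x y → Prefix y z → Prefix x z
Prefix-trans {x = x} (s , refl) (t , refl) = s ++ t , ++-assoc x s t

Factor-trans : Factor x y → Factor y z → Factor x z
Factor-trans {x = x} (p , s , refl) (p′ , s′ , refl) = p′ ++ p , s ++ s′ , (begin
  p′ ++ (p ++ x ++ s) ++ s′  ≡⟨ cong (p′ ++_) (++-assoc p (x ++ s) s′) ⟩
  p′ ++ p ++ (x ++ s) ++ s′  ≡⟨ cong (λ r → p′ ++ p ++ r) (++-assoc x s s′) ⟩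
  p′ ++ p ++ x ++ s ++ s′    ≡⟨ ++-assoc p′ p (x ++ s ++ s′) ⟨
  (p′ ++ p) ++ x ++ s ++ s′  ∎)

Factor-++ʳ : ∀ z → Factor x y → Factor x (y ++ z)
Factor-++ʳ z x∈y = Factor-trans x∈y (Prefix⇒Factor (z , refl))

Suffix-++ : ∀ z → Suffix x y → Suffix (x ++ z) (y ++ z)
Suffix-++ {x = x} z (p , refl) = p , ++-assoc p x z

∈-Factor : a ∈ x → Factor x y → a ∈ y
∈-Factor a∈x (p , s , refl) = ∈-++⁺ʳ p (∈-++⁺ˡ a∈x)

Suffix-dropˡ : ∀ (u : List A) {v} → u ++ y ≡ v ++ x → length x ≤ length y → Suffix x y
Suffix-dropˡ []                    eq  _   = _ , eq
Suffix-dropˡ {y = y} (b ∷ u) {[]}    refl x≤y =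
  ⊥-elim (<⇒≱ (s≤s (≤-trans (m≤n+m (length y) (length u)) (≤-reflexive (sym (length-++ u))))) x≤y)
Suffix-dropˡ         (b ∷ u) {_ ∷ v} eq  x≤y = Suffix-dropˡ u (∷-injectiveʳ eq) x≤y

right-extension : ∀ (star : A) → Factor y w →
  ∃ λ e → Factor (y ++ [ e ]) (w ++ [ star ]) × (e ≡ star ⊎ Factor (y ++ [ e ]) w)
right-extension {y = y} star (p , [] , refl) =
  star , Suffix⇒Factor (Suffix-++ [ star ] (p , cong (p ++_) (++-identityʳ y))) , inj₁ refl
right-extension {y = y} star (p , e ∷ s , refl) = e , Factor-++ʳ [ star ] ye∈w , inj₂ ye∈w
  where
  ye∈w = p , s , cong (p ++_) (sym (++-assoc y [ e ] s))

take-suc-< : ∀ (xs : List A) {r} → r < length xs → ∃ λ d → take (suc r) xs ≡ take r xs ++ [ d ]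
take-suc-< xs r<n =
  lookup xs i , subst (λ m → take (suc m) xs ≡ take m xs ++ [ lookup xs i ]) (toℕ-fromℕ< r<n) (take-suc xs i)
  where
  i = fromℕ< r<n

module Power {A : Set} (c : A) (cs : List A) where
  private
    u = c ∷ cs
    n = length u

  copies : ℕ → List A
  copies q = concat (replicate q u)

  copies-suc : ∀ q → copies (suc q) ≡ copies q ++ u
  copies-suc zero    = ++-identityʳ u
  copies-suc (suc q) = trans (cong (u ++_) (copies-suc q)) (sym (++-assoc u (copies q) u))

  pow-divMod : ∀ q {r} → r < n → pow u (r + q * n) ≡ copies q ++ take r u
  pow-divMod q {r} r<n = cong₂ (λ q′ r′ → copies q′ ++ take r′ u) quotient remainder
    where
    quotient : (r + q * n) / n ≡ q
    quotient = begin
      (r + q * n) / n    ≡⟨ +-distrib-/-∣ʳ r (n∣m*n q) ⟩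
      r / n + q * n / n  ≡⟨ cong₂ _+_ (m<n⇒m/n≡0 r<n) (m*n/n≡m q n) ⟩
      q                  ∎
    remainder : (r + q * n) % n ≡ r
    remainder = trans ([m+kn]%n≡m%n r q n) (m<n⇒m%n≡m r<n)

  pow-+-period : ∀ k → pow u (k + n) ≡ u ++ pow u k
  pow-+-period k = trans (cong₂ (λ q r → copies q ++ take r u) quotient ([m+n]%n≡m%n k n))
                         (++-assoc u (copies (k / n)) _)
    where
    quotient : (k + n) / n ≡ suc (k / n)
    quotient = trans (m/n≡1+[m∸n]/n (m≤n+m n k)) (cong (λ m → suc (m / n)) (m+n∸n≡m k n))

  pow-suc-divMod : ∀ q {r} → r < n → ∃ λ d → pow u (suc r + q * n) ≡ pow u (r + q * n) ++ [ d ]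
  pow-suc-divMod q {r} r<n with take-suc-< u r<n | m≤n⇒m<n∨m≡n r<n
  ... | d , take-next | inj₁ 1+r<n = d , (begin
    pow u (suc r + q * n)          ≡⟨ pow-divMod q 1+r<n ⟩
    copies q ++ take (suc r) u     ≡⟨ cong (copies q ++_) take-next ⟩
    copies q ++ take r u ++ [ d ]  ≡⟨ ++-assoc (copies q) _ _ ⟨
    (copies q ++ take r u) ++ [ d ] ≡⟨ cong (_++ [ d ]) (pow-divMod q r<n) ⟨
    pow u (r + q * n) ++ [ d ]     ∎)
  ... | d , take-next | inj₂ 1+r≡n = d , (begin
    pow u (suc r + q * n)          ≡⟨ cong (λ m → pow u (m + q * n)) 1+r≡n ⟩
    pow u (suc q * n)              ≡⟨ pow-divMod (suc q) (s≤s z≤n) ⟩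
    copies (suc q) ++ []           ≡⟨ ++-identityʳ _ ⟩
    copies (suc q)                 ≡⟨ copies-suc q ⟩
    copies q ++ u                  ≡⟨ cong (copies q ++_) u≡take-r++d ⟩
    copies q ++ take r u ++ [ d ]  ≡⟨ ++-assoc (copies q) _ _ ⟨
    (copies q ++ take r u) ++ [ d ] ≡⟨ cong (_++ [ d ]) (pow-divMod q r<n) ⟨
    pow u (r + q * n) ++ [ d ]     ∎)
    where
    u≡take-r++d : u ≡ take r u ++ [ d ]
    u≡take-r++d = trans (sym (take-all (suc r) u (≤-reflexive (sym 1+r≡n)))) take-next

  pow-suc : ∀ k → ∃ λ d → pow u (suc k) ≡ pow u k ++ [ d ]
  pow-suc k = subst (λ m → ∃ λ d → pow u (suc m) ≡ pow u m ++ [ d ])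
                    (sym (m≡m%n+[m/n]*n k n)) (pow-suc-divMod (k / n) (m%n<n k n))

  pow-mono-Prefix : ∀ {a b} → a ≤ b → Prefix (pow u a) (pow u b)
  pow-mono-Prefix a≤b = go (≤⇒≤′ a≤b)
    where
    go : ∀ {a b} → a ≤′ b → Prefix (pow u a) (pow u b)
    go ≤′-refl         = [] , sym (++-identityʳ _)
    go (≤′-step a≤′b) = Prefix-trans (go a≤′b) (_ , proj₂ (pow-suc _))

  pow-suc-+-period : ∀ {k d} → pow u (suc k) ≡ pow u k ++ [ d ] →
                     pow u (suc (k + n)) ≡ pow u (k + n) ++ [ d ]
  pow-suc-+-period {k} {d} next = begin
    pow u (suc k + n)        ≡⟨ pow-+-period (suc k) ⟩
    u ++ pow u (suc k)       ≡⟨ cong (u ++_) next ⟩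
    u ++ pow u k ++ [ d ]    ≡⟨ ++-assoc u _ _ ⟨
    (u ++ pow u k) ++ [ d ]  ≡⟨ cong (_++ [ d ]) (pow-+-period k) ⟨
    pow u (k + n) ++ [ d ]   ∎

  letter-after-pow : ∀ {k m} → k + n ≡ m →
    ∃ λ d → Prefix (pow u k ++ [ d ]) (pow u m) × pow u (suc m) ≡ pow u m ++ [ d ]
  letter-after-pow {k} refl =
    d , subst (λ y → Prefix y (pow u (k + n))) next (pow-mono-Prefix (m<m+n k (s≤s z≤n))) ,
    pow-suc-+-period next
    where
    d = proj₁ (pow-suc k)
    next : pow u (suc k) ≡ pow u k ++ [ d ]
    next = proj₂ (pow-suc k)

  IsUi⇒Suffix-pow-∸ : ∀ {M i x} → IsUi u M i x → i * n + n ≤ M → Suffix x (pow u (M ∸ n))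
  IsUi⇒Suffix-pow-∸ {M} {i} ((v , P≡v++x) , _ , shortest) i*n+n≤M =
    Suffix-dropˡ u (trans (sym P≡u++Q) P≡v++x)
      (shortest Q (u , P≡u++Q) (pow-mono-Prefix (m+n≤o⇒m≤o∸n (i * n) i*n+n≤M)))
    where
    Q = pow u (M ∸ n)
    P≡u++Q : pow u M ≡ u ++ Q
    P≡u++Q = trans (cong (pow u) (sym (m∸n+n≡m (m+n≤o⇒n≤o (i * n) i*n+n≤M)))) (pow-+-period (M ∸ n))

lemma3p1 : {A : Set} (w : List A) (star : A) → star ∉ w →
    (u : List A) → u ≢ [] → Factor u w →
    (M : ℕ) → IsMaxExp u w M → 2 * length u ≤ M →
    (i : ℕ) → 1 ≤ i → i * length u + length u ≤ M →
    (x : List A) → IsUi u M i x →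
    RightSpecial x (w ++ star ∷ [])
lemma3p1 w star star∉w [] u≢[] = ⊥-elim (u≢[] refl)
-- Only m(u) ≥ i + 1 is used.
lemma3p1 w star star∉w u@(c ∷ cs) _ _ M (_ , P∈w , maximal) _ i _ i*n+n≤M x Ui@((v , P≡v++x) , _)
  with Power.letter-after-pow c cs (m∸n+n≡m (m+n≤o⇒n≤o (i * length u) i*n+n≤M))
     | right-extension star P∈w
... | d , Kd-prefix , after-M | e , Pe∈w* , e-origin =
  d , e , d≢e e-origin , Factor-++ʳ [ star ] xd∈w ,
  Factor-trans (Suffix⇒Factor (Suffix-++ [ e ] (v , P≡v++x))) Pe∈w*
  where
  open Power c cs

  xd∈w : Factor (x ++ [ d ]) w
  xd∈w = Factor-trans (Suffix⇒Factor (Suffix-++ [ d ] (IsUi⇒Suffix-pow-∸ {i = i} Ui i*n+n≤M)))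
                      (Factor-trans (Prefix⇒Factor Kd-prefix) P∈w)

  d≢e : e ≡ star ⊎ Factor (pow u M ++ [ e ]) w → d ≢ e
  d≢e (inj₁ e≡star) d≡e =
    star∉w (subst (_∈ w) (trans d≡e e≡star) (∈-Factor (∈-++⁺ʳ x (here refl)) xd∈w))
  d≢e (inj₂ Pe∈w)   d≡e = 1+n≰n (maximal (suc M) (s≤s z≤n)
    (subst (λ y → Factor y w) (trans (cong (λ a → pow u M ++ [ a ]) (sym d≡e)) (sym after-M)) Pe∈w))
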